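{- Let $q$ be a power of $2$, $n\ge1$, and let $W$ be an $n$-dimensional Wild subspace over ${\rm GF}(q)$. Then $\{f(1): f\in W\}={\rm GF}(q^n)$.
   Context: Let $q$ be even and let $\mathfrak F$ be the set of all functions $f:{\rm GF}(q^n)\to{\rm GF}(q^n)$ with $f(0)=0$, a vector space over ${\rm GF}(q)$. A function $f\in\mathfrak F$ is an o-permutation over ${\rm GF}(q^n)$ if $f$ is a permutation of ${\rm GF}(q^n)$ and, for every $s\in{\rm GF}(q^n)$, the map $x\mapsto (f(x+s)+f(s))/x$ is a permutation of ${\rm GF}(q^n)\setminus\{0\}$. An $n$-dimensional Wild subspace over ${\rm GF}(q)$ is an $n$-dimensional ${\rm GF}(q)$-subspace $W$ of $\mathfrak F$ every nonzero element of which is an o-permutation over ${\rm GF}(q^n)$. -}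

module Defs where

open import Data.Nat using (ℕ; zero; suc; _^_; _≥_)
open import Data.Fin using (Fin)
import Data.Fin as Fin
open import Data.Product using (Σ; ∃; ∃-syntax; _×_; _,_)
open import Relation.Binary.PropositionalEquality using (_≡_; _≢_)
open import Relation.Nullary using (¬_)
open import Algebra.Core using (Op₁; Op₂)
open import Algebra.Structures using (IsCommutativeRing)
open import Function.Bundles using (_↔_)
open import Function.Definitions using (Injective)

-- A field, with propositional equality.  Inversion is a total operation
-- whose value at 0 is irrelevant (only x * x ⁻¹ ≡ 1 for x ≢ 0 is required).
record Field : Set₁ where
  infixl 6 _+_
  infixl 7 _*_
  field
    Carrier : Set
    _+_ _*_ : Op₂ Carrier
    -_      : Op₁ Carrier
    0# 1#   : Carrier
    _⁻¹     : Op₁ Carrier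
    isCommutativeRing : IsCommutativeRing _≡_ _+_ _*_ -_ 0# 1#
    0≢1     : 0# ≢ 1#
    inverseʳ : ∀ x → x ≢ 0# → x * (x ⁻¹) ≡ 1#

  ∑ : ∀ {n} → (Fin n → Carrier) → Carrier
  ∑ {zero}  v = 0#
  ∑ {suc n} v = v Fin.zero + ∑ (λ i → v (Fin.suc i))

  Fun : Set
  Fun = Carrier → Carrier

  In𝔉 : Fun → Set
  In𝔉 f = f 0# ≡ 0#

  IsPermutation : Fun → Set
  IsPermutation f = (∀ x y → f x ≡ f y → x ≡ y) × (∀ y → ∃[ x ] f x ≡ y)

  IsPermutationOfNonzero : Fun → Set
  IsPermutationOfNonzero h =
    (∀ x → x ≢ 0# → h x ≢ 0#) ×
    (∀ x y → x ≢ 0# → y ≢ 0# → h x ≡ h y → x ≡ y) ×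
    (∀ y → y ≢ 0# → ∃[ x ] (x ≢ 0# × h x ≡ y))

  IsOPermutation : Fun → Set
  IsOPermutation f =
    IsPermutation f ×
    (∀ s → IsPermutationOfNonzero (λ x → (f (x + s) + f s) * (x ⁻¹)))

  HasSize : ℕ → Set
  HasSize N = Carrier ↔ Fin N

  -- a subfield with q elements, given as an injective enumeration
  -- e : Fin q → Carrier whose image is closed under the field operations
  record Subfield (q : ℕ) : Set where
    field
      e     : Fin q → Carrier
      e-inj : Injective _≡_ _≡_ e
      has0  : ∃[ i ] e i ≡ 0#
      has1  : ∃[ i ] e i ≡ 1#
      +-closed : ∀ i j → ∃[ k ] e k ≡ e i + e j
      *-closed : ∀ i j → ∃[ k ] e k ≡ e i * e j
      neg-closed : ∀ i → ∃[ k ] e k ≡ - e i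
      inv-closed : ∀ i → e i ≢ 0# → ∃[ k ] e k ≡ e i ⁻¹

  lincomb : ∀ {q n} → Subfield q → (Fin n → Fun) → (Fin n → Fin q) → Fun
  lincomb K b c x = ∑ (λ i → Subfield.e K (c i) * b i x)

  -- b is a basis of an n-dimensional K-subspace of 𝔉 (elements of 𝔉,
  -- linearly independent over K); the subspace is {lincomb K b c}.
  record IsBasis {q n} (K : Subfield q) (b : Fin n → Fun) : Set where
    field
      in𝔉 : ∀ i → In𝔉 (b i)
      independent : ∀ c → (∀ x → lincomb K b c x ≡ 0#) → ∀ i → Subfield.e K (c i) ≡ 0#

  IsWild : ∀ {q n} (K : Subfield q) (b : Fin n → Fun) → Set
  IsWild K b = ∀ c → ¬ (∀ x → lincomb K b c x ≡ 0#) → IsOPermutation (lincomb K b c)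

IsPowerOf2 : ℕ → Set
IsPowerOf2 q = Σ ℕ (λ k → k ≥ 1 × q ≡ 2 ^ k)

{-# OPTIONS --safe #-}
-- Evaluation at 1 is a GF(q)-linear map from W to GF(q^n), and it is injective:
-- a nonzero element of W is a permutation fixing 0, so it cannot vanish at 1.
-- Both sides have q^n elements, so evaluation at 1 is onto.
module Submission where

open import Defs
open import Data.Nat using (ℕ; zero; suc; _^_; _≥_)
open import Data.Nat.Properties using (<-irrefl)
open import Data.Fin using (Fin; zero; suc; punchOut; finToFun; funToFin; combine)
open import Data.Fin.Properties using (any?; _≟_; injective⇒≤; punchOut-injective; funToFin-finToFin)
open import Data.Product using (∃-syntax; _,_; proj₁; proj₂)
open import Data.Empty using (⊥-elim)
open import Function.Base using (_∘_)
open import Function.Bundles using (_↔_; module Injection)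
open import Function.Definitions using (Injective)
open import Function.Properties.Inverse using (↔⇒↣)
open import Relation.Binary.Definitions using (DecidableEquality)
open import Relation.Binary.PropositionalEquality
open import Relation.Nullary using (yes; no)
open import Relation.Nullary.Decidable using (via-injection)
open import Algebra.Bundles using (CommutativeRing)
import Algebra.Properties.Ring as RingProperties
import Algebra.Properties.CommutativeSemigroup as CommutativeSemigroupProperties

injective⇒surjective : ∀ {N} {f : Fin N → Fin N} → Injective _≡_ _≡_ f →
                       ∀ y → ∃[ x ] f x ≡ y
injective⇒surjective {suc N} {f} f-injective y with any? (λ x → f x ≟ y)
... | yes hit = hit
... | no miss = ⊥-elim (<-irrefl refl (injective⇒≤ f∖y-injective))
  where
  y≢f : ∀ x → y ≢ f x
  y≢f x y≡fx = miss (x , sym y≡fx)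

  f∖y : Fin (suc N) → Fin N
  f∖y x = punchOut (y≢f x)

  f∖y-injective : Injective _≡_ _≡_ f∖y
  f∖y-injective {x} {x'} eq = f-injective (punchOut-injective (y≢f x) (y≢f x') eq)

funToFin-cong : ∀ {m n} {f g : Fin m → Fin n} → f ≗ g → funToFin f ≡ funToFin g
funToFin-cong {zero}  f≗g = refl
funToFin-cong {suc m} f≗g = cong₂ combine (f≗g zero) (funToFin-cong (f≗g ∘ suc))

finToFun-injective : ∀ {m n} {a a' : Fin (m ^ n)} →
                     finToFun {m} {n} a ≗ finToFun a' → a ≡ a'
finToFun-injective {m} {n} {a} {a'} eq = begin
  a                                ≡⟨ funToFin-finToFin {n} {m} a ⟨
  funToFin (finToFun {m} {n} a)    ≡⟨ funToFin-cong eq ⟩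
  funToFin (finToFun {m} {n} a')   ≡⟨ funToFin-finToFin {n} {m} a' ⟩
  a'                               ∎
  where open ≡-Reasoning

≗-injective⇒surjective : ∀ {A : Set} {q n} → A ↔ Fin (q ^ n) →
                         (φ : (Fin n → Fin q) → A) →
                         (∀ {c c'} → φ c ≡ φ c' → c ≗ c') →
                         ∀ y → ∃[ c ] φ c ≡ y
≗-injective⇒surjective {q = q} {n} A↔ φ φ-injective y =
  let a , ψa≡y = injective⇒surjective ψ-injective (to y) in finToFun {q} {n} a , injective ψa≡y
  where
  open Injection (↔⇒↣ A↔) using (to; injective)

  ψ : Fin (q ^ n) → Fin (q ^ n)
  ψ = to ∘ φ ∘ finToFun {q} {n}

  ψ-injective : Injective _≡_ _≡_ ψ
  ψ-injective eq = finToFun-injective {q} {n} (φ-injective (injective eq))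

module _ (F : Field) where
  open Field F

  commutativeRing : CommutativeRing _ _
  commutativeRing = record { isCommutativeRing = isCommutativeRing }

  open CommutativeRing commutativeRing
    using (_-_; +-identityʳ; -‿inverseʳ; zeroʳ; ring; +-commutativeSemigroup)
  open RingProperties ring using (-‿+-comm; [y-z]x≈yx-zx; x∙y⁻¹≈ε⇒x≈y)
  open CommutativeSemigroupProperties +-commutativeSemigroup using (interchange)

  hasSize⇒decidableEquality : ∀ {N} → HasSize N → DecidableEquality Carrier
  hasSize⇒decidableEquality size = via-injection (↔⇒↣ size) _≟_

  ∑-cong : ∀ {n} {u v : Fin n → Carrier} → u ≗ v → ∑ u ≡ ∑ v
  ∑-cong {zero}  u≗v = refl
  ∑-cong {suc n} u≗v = cong₂ _+_ (u≗v zero) (∑-cong (u≗v ∘ suc))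

  ∑-0 : ∀ n → ∑ {n} (λ _ → 0#) ≡ 0#
  ∑-0 zero    = refl
  ∑-0 (suc n) = trans (cong (0# +_) (∑-0 n)) (+-identityʳ 0#)

  ∑-distrib-- : ∀ {n} (u v : Fin n → Carrier) → ∑ (λ i → u i - v i) ≡ ∑ u - ∑ v
  ∑-distrib-- {zero}  u v = sym (-‿inverseʳ 0#)
  ∑-distrib-- {suc n} u v = begin
    (u zero - v zero) + ∑ (λ i → u (suc i) - v (suc i))
      ≡⟨ cong ((u zero - v zero) +_) (∑-distrib-- (u ∘ suc) (v ∘ suc)) ⟩
    (u zero - v zero) + (∑ (u ∘ suc) - ∑ (v ∘ suc))
      ≡⟨ interchange (u zero) (- v zero) (∑ (u ∘ suc)) (- ∑ (v ∘ suc)) ⟩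
    (u zero + ∑ (u ∘ suc)) + (- v zero + - ∑ (v ∘ suc))
      ≡⟨ cong ((u zero + ∑ (u ∘ suc)) +_) (-‿+-comm (v zero) (∑ (v ∘ suc))) ⟩
    (u zero + ∑ (u ∘ suc)) - (v zero + ∑ (v ∘ suc))
      ∎
    where open ≡-Reasoning

  module _ {q} (K : Subfield q) where
    open Subfield K

    sub-closed : ∀ i j → ∃[ k ] e k ≡ e i - e j
    sub-closed i j =
      let k , ek≡-ej = neg-closed j
          l , el≡ei+ek = +-closed i k
      in l , trans el≡ei+ek (cong (e i +_) ek≡-ej)

    module _ {n} {b : Fin n → Fun} where

      lincomb-in𝔉 : (∀ i → In𝔉 (b i)) → ∀ c → In𝔉 (lincomb K b c)
      lincomb-in𝔉 b∈𝔉 c =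
        trans (∑-cong (λ i → trans (cong (e (c i) *_) (b∈𝔉 i)) (zeroʳ _))) (∑-0 n)

      lincomb-sub : ∀ {c c' d} → (∀ i → e (d i) ≡ e (c i) - e (c' i)) →
                    ∀ x → lincomb K b d x ≡ lincomb K b c x - lincomb K b c' x
      lincomb-sub {c} {c'} d≡c-c' x = trans
        (∑-cong (λ i → trans (cong (_* b i x) (d≡c-c' i)) ([y-z]x≈yx-zx _ _ _)))
        (∑-distrib-- (λ i → e (c i) * b i x) (λ i → e (c' i) * b i x))

      module _ (_≟F_ : DecidableEquality Carrier) (basis : IsBasis K b) (wild : IsWild K b) where
        open IsBasis basis

        -- Wildness only refutes that the lincomb is nonzero; decidable equality
        -- turns this double negation into pointwise vanishing.
        wild-lincomb-vanishing-at-1 : ∀ d → lincomb K b d 1# ≡ 0# → ∀ x → lincomb K b d x ≡ 0#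
        wild-lincomb-vanishing-at-1 d at1≡0 x with lincomb K b d x ≟F 0#
        ... | yes atx≡0 = atx≡0
        ... | no  atx≢0 = ⊥-elim (0≢1 (sym (injective 1# 0# (trans at1≡0 (sym (lincomb-in𝔉 in𝔉 d))))))
          where
          injective : ∀ x y → lincomb K b d x ≡ lincomb K b d y → x ≡ y
          injective = proj₁ (proj₁ (wild d (λ ≡0 → atx≢0 (≡0 x))))

        lincomb-at-1-injective : ∀ {c c'} → lincomb K b c 1# ≡ lincomb K b c' 1# → c ≗ c'
        lincomb-at-1-injective {c} {c'} eq i =
          e-inj (x∙y⁻¹≈ε⇒x≈y _ _ (trans (sym (d≡c-c' i)) (independent d d≡0 i)))
          where
          d : Fin n → Fin q
          d i = proj₁ (sub-closed (c i) (c' i))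

          d≡c-c' : ∀ i → e (d i) ≡ e (c i) - e (c' i)
          d≡c-c' i = proj₂ (sub-closed (c i) (c' i))

          d≡0 : ∀ x → lincomb K b d x ≡ 0#
          d≡0 = wild-lincomb-vanishing-at-1 d (begin
            lincomb K b d 1#                        ≡⟨ lincomb-sub d≡c-c' 1# ⟩
            lincomb K b c 1# - lincomb K b c' 1#    ≡⟨ cong (_- lincomb K b c' 1#) eq ⟩
            lincomb K b c' 1# - lincomb K b c' 1#   ≡⟨ -‿inverseʳ _ ⟩
            0#                                      ∎)
            where open ≡-Reasoning

corollary1 : (F : Field) → (q n : ℕ) → IsPowerOf2 q → n ≥ 1 →
    Field.HasSize F (q ^ n) → (K : Field.Subfield F q) →
    (b : Fin n → Field.Fun F) → Field.IsBasis F K b → Field.IsWild F K b →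
    ∀ y → ∃[ c ] Field.lincomb F K b c (Field.1# F) ≡ y
corollary1 F q n _ _ size K b basis wild =
  ≗-injective⇒surjective {q = q} {n} size (λ c → lincomb K b c 1#)
    (lincomb-at-1-injective F K (hasSize⇒decidableEquality F size) basis wild)
  where open Field F using (lincomb; 1#)
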